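{- Let $p$ be a prime number and let $d$ be a positive integer. There exist positive integers $u, v$ such that $(du, dv, duv)$ is a solution for $p$ (that is, $\frac{4}{p} = \frac{1}{du} + \frac{1}{dv} + \frac{1}{duv}$ with $du \le dv \le duv$) if and only if there exists a positive integer $n$ such that $$p \equiv -4d \pmod{4dn-1}.$$ Moreover, for any such solution $(du, dv, duv)$ for $p$, $\gcd(u,v) = 1$.
   Context: For a positive integer $p$, a solution for $p$ is a triple $(x,y,z)$ of positive integers with $x \le y \le z$ and $\frac{4}{p} = \frac{1}{x} + \frac{1}{y} + \frac{1}{z}$. -}

module Defs where

open import Data.Nat using (ℕ; zero; suc; _≤_; _<_)
open import Data.Integer using (+_)
open import Data.Rational using (ℚ; _/_; _+_; 0ℚ)
open import Data.Product using (_×_)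
open import Relation.Binary.PropositionalEquality using (_≡_)

-- k/n as a rational; the value at n = 0 is a junk convention (0) that is
-- never used, since all denominators below are required to be positive.
frac : ℕ → ℕ → ℚ
frac k zero    = 0ℚ
frac k (suc n) = (+ k) / suc n

Solution : ℕ → ℕ → ℕ → ℕ → Set
Solution p x y z =
  0 < p × 0 < x × 0 < y × 0 < z × x ≤ y × y ≤ z ×
  frac 4 p ≡ frac 1 x + frac 1 y + frac 1 z

-- Clearing denominators, (du, dv, duv) solves 4/p = 1/x + 1/y + 1/z exactly when
-- 4duv = p(u + v + 1). A prime p dividing 4duv cannot divide d, and for p = 2 a parity
-- argument applies, so p divides u or v, say u = pn. Then (4dn − 1)v = pn + 1, and
-- 4d(pn + 1) = p(4dn − 1) + p + 4d shows 4dn − 1 ∣ p + 4d. Conversely, if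
-- (4dn − 1)m = p + 4d then 4d·mn = p + m + 4d, so c = mn − 1 satisfies 4dc = p + m and
-- (pn, c) solves 4duv = p(u + v + 1). Finally gcd u v divides p(u + v + 1) − p(u + v) = p,
-- and it is not p, since p ∣ u and p ∣ v would give p ∣ u + v + 1 − (u + v) = 1.
{-# OPTIONS --safe #-}
module Submission where

open import Defs
open import Data.Nat using (ℕ; zero; suc; _+_; _*_; _∸_; _<_; _≤_; z<s; >-nonZero; >-nonZero⁻¹; nonTrivial⇒n>1)
open import Data.Nat.Properties
open import Data.Nat.Divisibility
open import Data.Nat.GCD using (gcd; gcd[m,n]∣m; gcd[m,n]∣n)
open import Data.Nat.Primality using (Prime; euclidsLemma; prime⇒irreducible; prime⇒nonZero; prime⇒nonTrivial; ¬prime[1])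
open import Data.Nat.Tactic.RingSolver using (solve; solve-∀)
open import Data.Integer using (+_)
import Data.Integer.Properties as ℤ
open import Data.Rational as ℚ using (fromℚᵘ)
open import Data.Rational.Properties using (toℚᵘ-cong; toℚᵘ-fromℚᵘ; toℚᵘ-homo-+; toℚᵘ-injective)
open import Data.Rational.Unnormalised as ℚᵘ using (ℚᵘ; mkℚᵘ; *≡*; _≃_)
import Data.Rational.Unnormalised.Properties as ℚᵘ
open import Data.List.Base using (_∷_; [])
open import Data.Product using (_×_; _,_; ∃)
open import Data.Sum using (_⊎_; inj₁; inj₂; reduce)
open import Function.Base using (_∘_)
open import Function.Bundles using (_⇔_; mk⇔; Equivalence)
open import Relation.Nullary using (¬_; contradiction)
open import Relation.Binary.PropositionalEquality
open ≡-Reasoning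

prime>0 : ∀ {p} → Prime p → 0 < p
prime>0 {p} pp = >-nonZero⁻¹ p {{prime⇒nonZero pp}}

*-pos : ∀ {m n} → 0 < m → 0 < n → 0 < m * n
*-pos {suc _} {suc _} _ _ = z<s

4/P≡1/X+1/Y+1/Z⇔ : ∀ P X Y Z → 0 < P → 0 < X → 0 < Y → 0 < Z →
  (frac 4 P ≡ frac 1 X ℚ.+ frac 1 Y ℚ.+ frac 1 Z) ⇔
  (4 * (X * Y * Z) ≡ (Y * Z + X * Z + X * Y) * P)
4/P≡1/X+1/Y+1/Z⇔ P@(suc p) X@(suc x) Y@(suc y) Z@(suc z) _ _ _ _ = mk⇔ to from
  where
  unit : ℕ → ℚᵘ
  unit n = mkℚᵘ (+ 1) n

  lhs : ℚᵘ
  lhs = mkℚᵘ (+ 4) p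

  sum-unnormalised : ℚ.toℚᵘ (frac 1 X ℚ.+ frac 1 Y ℚ.+ frac 1 Z) ≃ unit x ℚᵘ.+ unit y ℚᵘ.+ unit z
  sum-unnormalised = ℚᵘ.≃-trans (toℚᵘ-homo-+ (fromℚᵘ (unit x) ℚ.+ fromℚᵘ (unit y)) (fromℚᵘ (unit z)))
    (ℚᵘ.+-cong (ℚᵘ.≃-trans (toℚᵘ-homo-+ (fromℚᵘ (unit x)) (fromℚᵘ (unit y)))
                           (ℚᵘ.+-cong (toℚᵘ-fromℚᵘ (unit x)) (toℚᵘ-fromℚᵘ (unit y))))
               (toℚᵘ-fromℚᵘ (unit z)))

  normalise′ : ∀ P X Y Z → ((1 * Y + 1 * X) * Z + 1 * (X * Y)) * P ≡ (Y * Z + X * Z + X * Y) * P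
  normalise′ = solve-∀
  normalise = normalise′ P X Y Z

  to : frac 4 P ≡ frac 1 X ℚ.+ frac 1 Y ℚ.+ frac 1 Z → 4 * (X * Y * Z) ≡ (Y * Z + X * Z + X * Y) * P
  to eq with ℚᵘ.≃-trans (ℚᵘ.≃-sym (toℚᵘ-fromℚᵘ lhs)) (ℚᵘ.≃-trans (toℚᵘ-cong eq) sum-unnormalised)
  ... | *≡* e = trans (ℤ.+-injective e) normalise

  from : 4 * (X * Y * Z) ≡ (Y * Z + X * Z + X * Y) * P → frac 4 P ≡ frac 1 X ℚ.+ frac 1 Y ℚ.+ frac 1 Z
  from e = toℚᵘ-injective (ℚᵘ.≃-trans (toℚᵘ-fromℚᵘ lhs)
    (ℚᵘ.≃-trans (*≡* (cong +_ (trans e (sym normalise)))) (ℚᵘ.≃-sym sum-unnormalised)))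

-- 4/p = 1/(du) + 1/(dv) + 1/(duv), multiplied through by p·d·u·v.
ReducedEquation : ℕ → ℕ → ℕ → ℕ → Set
ReducedEquation p d u v = 4 * d * u * v ≡ p * (u + v + 1)

reducedEquation-sym : ∀ {p d u v} → ReducedEquation p d u v → ReducedEquation p d v u
reducedEquation-sym {p} {d} {u} {v} eq = begin
  4 * d * v * u    ≡⟨ solve (d ∷ u ∷ v ∷ []) ⟩
  4 * d * u * v    ≡⟨ eq ⟩
  p * (u + v + 1)  ≡⟨ cong (λ s → p * (s + 1)) (+-comm u v) ⟩
  p * (v + u + 1)  ∎

cleared⇔reducedEquation : ∀ p d u v → 0 < d → 0 < u → 0 < v →
  (4 * (d * u * (d * v) * (d * u * v))
     ≡ (d * v * (d * u * v) + d * u * (d * u * v) + d * u * (d * v)) * p)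
  ⇔ ReducedEquation p d u v
cleared⇔reducedEquation p d u v d>0 u>0 v>0 =
  mk⇔ (λ eq → *-cancelˡ-≡ _ _ (d * d * u * v) {{>-nonZero d²uv>0}} (trans (sym lhs) (trans eq rhs)))
      (λ eq → trans lhs (trans (cong (d * d * u * v *_) eq) (sym rhs)))
  where
  d²uv>0 = *-pos (*-pos (*-pos d>0 d>0) u>0) v>0
  lhs : 4 * (d * u * (d * v) * (d * u * v)) ≡ d * d * u * v * (4 * d * u * v)
  lhs = solve (d ∷ u ∷ v ∷ [])
  rhs : (d * v * (d * u * v) + d * u * (d * u * v) + d * u * (d * v)) * p
          ≡ d * d * u * v * (p * (u + v + 1))
  rhs = solve (p ∷ d ∷ u ∷ v ∷ [])

solution⇒reducedEquation : ∀ {p d u v} → 0 < d → 0 < u → 0 < v →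
  Solution p (d * u) (d * v) (d * u * v) → ReducedEquation p d u v
solution⇒reducedEquation {p} {d} {u} {v} d>0 u>0 v>0 (p>0 , du>0 , dv>0 , duv>0 , _ , _ , eq) =
  Equivalence.to (cleared⇔reducedEquation p d u v d>0 u>0 v>0)
    (Equivalence.to (4/P≡1/X+1/Y+1/Z⇔ p (d * u) (d * v) (d * u * v) p>0 du>0 dv>0 duv>0) eq)

reducedEquation⇒solution : ∀ {p d u v} → 0 < p → 0 < d → 0 < u → 0 < v → u ≤ v →
  ReducedEquation p d u v → Solution p (d * u) (d * v) (d * u * v)
reducedEquation⇒solution {p} {d} {u} {v} p>0 d>0 u>0 v>0 u≤v eq =
  p>0 , du>0 , *-pos d>0 v>0 , duv>0 , *-monoʳ-≤ d u≤v , dv≤duv ,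
  Equivalence.from (4/P≡1/X+1/Y+1/Z⇔ p (d * u) (d * v) (d * u * v) p>0 du>0 (*-pos d>0 v>0) duv>0)
    (Equivalence.from (cleared⇔reducedEquation p d u v d>0 u>0 v>0) eq)
  where
  du>0 = *-pos d>0 u>0
  duv>0 = *-pos du>0 v>0
  dv≤duv : d * v ≤ d * u * v
  dv≤duv = ≤-trans (m≤m*n (d * v) u {{>-nonZero u>0}}) (≤-reflexive (solve (d ∷ u ∷ v ∷ [])))

reducedEquation⇒orderedSolution : ∀ {p d u v} → 0 < p → 0 < d → 0 < u → 0 < v →
  ReducedEquation p d u v →
  ∃ λ u′ → ∃ λ v′ → 0 < u′ × 0 < v′ × Solution p (d * u′) (d * v′) (d * u′ * v′)
reducedEquation⇒orderedSolution {p} {d} {u} {v} p>0 d>0 u>0 v>0 eq with ≤-total u v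
... | inj₁ u≤v = u , v , u>0 , v>0 , reducedEquation⇒solution p>0 d>0 u>0 v>0 u≤v eq
... | inj₂ v≤u = v , u , v>0 , u>0 ,
  reducedEquation⇒solution p>0 d>0 v>0 u>0 v≤u (reducedEquation-sym {p} {d} {u} eq)

4kuv≢u+v+1 : ∀ k u v → 0 < u → 0 < v → 4 * k * u * v ≢ u + v + 1
4kuv≢u+v+1 zero (suc u) (suc v) _ _ ()
4kuv≢u+v+1 (suc k) (suc u) (suc v) _ _ eq = m+1+n≢m (suc u + suc v + 1) (sym (trans (sym eq) excess))
  where
  excess : 4 * suc k * suc u * suc v
             ≡ suc u + suc v + 1 + suc (3 * u + 3 * v + 4 * u * v + 4 * k * suc u * suc v)
  excess = solve (k ∷ u ∷ v ∷ [])

divisor-of-d⇒¬reducedEquation : ∀ {p d u v} → 0 < p → 0 < u → 0 < v → p ∣ d → ¬ ReducedEquation p d u v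
divisor-of-d⇒¬reducedEquation {p} {_} {u} {v} p>0 u>0 v>0 (divides-refl k) eq =
  4kuv≢u+v+1 k u v u>0 v>0 (*-cancelˡ-≡ _ _ p {{>-nonZero p>0}} (trans regroup eq))
  where
  regroup : p * (4 * k * u * v) ≡ 4 * (k * p) * u * v
  regroup = solve (p ∷ k ∷ u ∷ v ∷ [])

prime∣4⇒≡2 : ∀ {p} → Prime p → p ∣ 4 → p ≡ 2
prime∣4⇒≡2 {p} pp p∣4 =
  ≤-antisym (∣⇒≤ (reduce (euclidsLemma 2 2 pp p∣4))) (nonTrivial⇒n>1 p {{prime⇒nonTrivial pp}})

even⊎odd : ∀ n → 2 ∣ n ⊎ ∃ λ k → n ≡ 1 + k * 2
even⊎odd zero = inj₁ (divides 0 refl)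
even⊎odd (suc zero) = inj₂ (0 , refl)
even⊎odd (suc (suc n)) with even⊎odd n
... | inj₁ (divides q refl) = inj₁ (divides (suc q) refl)
... | inj₂ (k , refl) = inj₂ (suc k , refl)

reducedEquation[2]⇒2∣u⊎2∣v : ∀ {d u v} → ReducedEquation 2 d u v → 2 ∣ u ⊎ 2 ∣ v
reducedEquation[2]⇒2∣u⊎2∣v {d} {u} {v} eq with even⊎odd u | even⊎odd v
... | inj₁ 2∣u | _         = inj₁ 2∣u
... | inj₂ _   | inj₁ 2∣v  = inj₂ 2∣v
... | inj₂ (a , refl) | inj₂ (b , refl) = contradiction even≡odd (even≢odd (d * u * v) (a + b + 1))
  where
  halve : 2 * (2 * (d * u * v)) ≡ 2 * (1 + (a + b + 1) * 2)
  halve = begin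
    2 * (2 * (d * u * v))  ≡⟨ solve (d ∷ a ∷ b ∷ []) ⟩
    4 * d * u * v          ≡⟨ eq ⟩
    2 * (u + v + 1)        ≡⟨ solve (a ∷ b ∷ []) ⟩
    2 * (1 + (a + b + 1) * 2) ∎
  even≡odd : 2 * (d * u * v) ≡ suc (2 * (a + b + 1))
  even≡odd = trans (*-cancelˡ-≡ _ _ 2 halve) (cong suc (*-comm (a + b + 1) 2))

prime∣u⊎prime∣v : ∀ {p d u v} → Prime p → 0 < u → 0 < v → ReducedEquation p d u v → p ∣ u ⊎ p ∣ v
prime∣u⊎prime∣v {p} {d} {u} {v} pp u>0 v>0 eq
  with euclidsLemma (4 * d * u) v pp (divides (u + v + 1) (trans eq (*-comm p _)))
... | inj₂ p∣v = inj₂ p∣v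
... | inj₁ p∣4du with euclidsLemma (4 * d) u pp p∣4du
...   | inj₂ p∣u = inj₁ p∣u
...   | inj₁ p∣4d with euclidsLemma 4 d pp p∣4d
...     | inj₂ p∣d = contradiction eq
                       (divisor-of-d⇒¬reducedEquation (prime>0 pp) u>0 v>0 p∣d)
...     | inj₁ p∣4 rewrite prime∣4⇒≡2 pp p∣4 = reducedEquation[2]⇒2∣u⊎2∣v {d} eq

modulus∣p+4d : ∀ {p d n v e} → 0 < p → suc e ≡ 4 * d * n → ReducedEquation p d (n * p) v → e ∣ p + 4 * d
modulus∣p+4d {p} {d} {n} {v} {e} p>0 1+e≡4dn eq = ∣m+n∣m⇒∣n e∣ep+[p+4d] (m∣m*n p)
  where
  4dnv≡np+v+1 : 4 * d * n * v ≡ n * p + v + 1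
  4dnv≡np+v+1 = *-cancelˡ-≡ _ _ p {{>-nonZero p>0}} (begin
    p * (4 * d * n * v)    ≡⟨ solve (p ∷ d ∷ n ∷ v ∷ []) ⟩
    4 * d * (n * p) * v    ≡⟨ eq ⟩
    p * (n * p + v + 1)    ∎)
  ev≡np+1 : e * v ≡ n * p + 1
  ev≡np+1 = +-cancelʳ-≡ v _ _ (begin
    e * v + v       ≡⟨ solve (e ∷ v ∷ []) ⟩
    (1 + e) * v     ≡⟨ cong (_* v) 1+e≡4dn ⟩
    4 * d * n * v   ≡⟨ 4dnv≡np+v+1 ⟩
    n * p + v + 1   ≡⟨ solve (n ∷ p ∷ v ∷ []) ⟩
    n * p + 1 + v   ∎)
  e∣ep+[p+4d] : e ∣ e * p + (p + 4 * d)
  e∣ep+[p+4d] = divides (4 * d * v) (begin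
    e * p + (p + 4 * d)     ≡⟨ solve (e ∷ p ∷ d ∷ []) ⟩
    (1 + e) * p + 4 * d     ≡⟨ cong (λ t → t * p + 4 * d) 1+e≡4dn ⟩
    4 * d * n * p + 4 * d   ≡⟨ solve (d ∷ n ∷ p ∷ []) ⟩
    4 * d * (n * p + 1)     ≡⟨ cong (4 * d *_) ev≡np+1 ⟨
    4 * d * (e * v)         ≡⟨ solve (d ∷ e ∷ v ∷ []) ⟩
    4 * d * v * e           ∎)

prime∣u⇒modulus : ∀ {p d u v} → 0 < p → 0 < d → 0 < u → ReducedEquation p d u v → p ∣ u →
  ∃ λ n → 0 < n × (4 * d * n ∸ 1) ∣ p + 4 * d
prime∣u⇒modulus _ _ () _ (divides-refl zero)
-- For positive d and n, 4 * d * n ∸ 1 is definitionally the e with suc e ≡ 4 * d * n.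
prime∣u⇒modulus {d = d@(suc _)} p>0 _ _ eq (divides-refl n@(suc _)) =
  n , z<s , modulus∣p+4d {d = d} {n} p>0 refl eq

reducedEquation⇒modulus : ∀ {p d u v} → Prime p → 0 < d → 0 < u → 0 < v → ReducedEquation p d u v →
  ∃ λ n → 0 < n × (4 * d * n ∸ 1) ∣ p + 4 * d
reducedEquation⇒modulus {p} {d} {u} pp d>0 u>0 v>0 eq with prime∣u⊎prime∣v {d = d} pp u>0 v>0 eq
... | inj₁ p∣u = prime∣u⇒modulus (prime>0 pp) d>0 u>0 eq p∣u
... | inj₂ p∣v = prime∣u⇒modulus (prime>0 pp) d>0 v>0 (reducedEquation-sym {p} {d} {u} eq) p∣v

modulus⇒cofactor : ∀ {p d n m e} → 0 < p → suc e ≡ 4 * d * n → p + 4 * d ≡ m * e →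
  ∃ λ c → 0 < c × m * n ≡ suc c × 4 * d * c ≡ p + m
modulus⇒cofactor {p} {d} {n} {m} {e} p>0 1+e≡4dn eq = cofactor (m * n) 4d[mn]≡p+m+4d
  where
  4d[mn]≡p+m+4d : 4 * d * (m * n) ≡ p + m + 4 * d
  4d[mn]≡p+m+4d = begin
    4 * d * (m * n)   ≡⟨ solve (d ∷ m ∷ n ∷ []) ⟩
    m * (4 * d * n)   ≡⟨ cong (m *_) 1+e≡4dn ⟨
    m * (1 + e)       ≡⟨ solve (m ∷ e ∷ []) ⟩
    m * e + m         ≡⟨ cong (_+ m) eq ⟨
    p + 4 * d + m     ≡⟨ solve (p ∷ d ∷ m ∷ []) ⟩
    p + m + 4 * d     ∎
  0≢p+m : 0 ≢ p + m
  0≢p+m = <⇒≢ (≤-trans p>0 (m≤m+n p m))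
  cofactor : ∀ k → 4 * d * k ≡ p + m + 4 * d → ∃ λ c → 0 < c × k ≡ suc c × 4 * d * c ≡ p + m
  cofactor zero h =
    contradiction (m+n≡0⇒m≡0 (p + m) (sym (trans (sym (*-zeroʳ (4 * d))) h))) (0≢p+m ∘ sym)
  cofactor (suc c) h
    with +-cancelʳ-≡ (4 * d) (4 * d * c) (p + m) (trans (+-comm _ (4 * d)) (trans (sym (*-suc (4 * d) c)) h))
  ... | 4dc≡p+m with c
  ...   | zero  = contradiction (trans (sym (*-zeroʳ (4 * d))) 4dc≡p+m) 0≢p+m
  ...   | suc _ = suc _ , z<s , refl , 4dc≡p+m

cofactor⇒reducedEquation : ∀ {p d n m c} → m * n ≡ suc c → 4 * d * c ≡ p + m →
  ReducedEquation p d (p * n) c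
cofactor⇒reducedEquation {p} {d} {n} {m} {c} mn≡1+c 4dc≡p+m = begin
  4 * d * (p * n) * c      ≡⟨ solve (d ∷ p ∷ n ∷ c ∷ []) ⟩
  p * n * (4 * d * c)      ≡⟨ cong (p * n *_) 4dc≡p+m ⟩
  p * n * (p + m)          ≡⟨ solve (p ∷ n ∷ m ∷ []) ⟩
  p * (p * n + m * n)      ≡⟨ cong (λ t → p * (p * n + t)) mn≡1+c ⟩
  p * (p * n + (1 + c))    ≡⟨ solve (p ∷ n ∷ c ∷ []) ⟩
  p * (p * n + c + 1)      ∎

modulus⇒reducedEquation : ∀ {p d n} → 0 < p → 0 < d → 0 < n → (4 * d * n ∸ 1) ∣ p + 4 * d →
  ∃ λ c → 0 < c × ReducedEquation p d (p * n) c
modulus⇒reducedEquation {d = d@(suc _)} {n@(suc _)} p>0 _ _ (divides m eq)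
  with modulus⇒cofactor {d = d} {n} p>0 refl eq
... | c , c>0 , mn≡1+c , 4dc≡p+m = c , c>0 , cofactor⇒reducedEquation {d = d} {n} {m} mn≡1+c 4dc≡p+m

common-divisor⇒≡1 : ∀ {p d u v} → 0 < p → ReducedEquation p d u v → p ∣ u → p ∣ v → p ≡ 1
common-divisor⇒≡1 {p} {d} p>0 eq (divides-refl a) (divides-refl b) =
  ∣1⇒≡1 (∣m+n∣m⇒∣n p∣[a+b]p+1 (n∣m*n (a + b)))
  where
  p∣[a+b]p+1 : p ∣ (a + b) * p + 1
  p∣[a+b]p+1 = divides (4 * d * a * b) (sym (*-cancelˡ-≡ _ _ p {{>-nonZero p>0}} (begin
    p * (4 * d * a * b * p)      ≡⟨ solve (p ∷ d ∷ a ∷ b ∷ []) ⟩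
    4 * d * (a * p) * (b * p)    ≡⟨ eq ⟩
    p * (a * p + b * p + 1)      ≡⟨ solve (p ∷ a ∷ b ∷ []) ⟩
    p * ((a + b) * p + 1)        ∎)))

common-divisor∣p : ∀ {p d u v g} → ReducedEquation p d u v → g ∣ u → g ∣ v → g ∣ p
common-divisor∣p {p} {d} {u} {v} {g} eq g∣u g∣v =
  ∣m+n∣m⇒∣n (subst (g ∣_) (trans eq split) (∣-trans g∣v (n∣m*n (4 * d * u))))
            (∣-trans (∣m∣n⇒∣m+n g∣u g∣v) (n∣m*n p))
  where
  split : p * (u + v + 1) ≡ p * (u + v) + p
  split = solve (p ∷ u ∷ v ∷ [])

reducedEquation⇒coprime : ∀ {p d u v} → Prime p → ReducedEquation p d u v → gcd u v ≡ 1
reducedEquation⇒coprime {p} {d} {u} {v} pp eq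
  with prime⇒irreducible pp (common-divisor∣p {d = d} eq (gcd[m,n]∣m u v) (gcd[m,n]∣n u v))
... | inj₁ g≡1 = g≡1
... | inj₂ g≡p = contradiction
  (common-divisor⇒≡1 {d = d} (prime>0 pp) eq
     (subst (_∣ u) g≡p (gcd[m,n]∣m u v)) (subst (_∣ v) g≡p (gcd[m,n]∣n u v)))
  (λ p≡1 → ¬prime[1] (subst Prime p≡1 pp))

mainTheorem1 : (p d : ℕ) → Prime p → 0 < d →
    ((∃ λ u → ∃ λ v → 0 < u × 0 < v × Solution p (d * u) (d * v) (d * u * v))
      ⇔ (∃ λ n → 0 < n × (4 * d * n ∸ 1) ∣ (p + 4 * d)))
    × ((u v : ℕ) → 0 < u → 0 < v → Solution p (d * u) (d * v) (d * u * v) → gcd u v ≡ 1)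
mainTheorem1 p d pp d>0 = mk⇔ solution⇒modulus modulus⇒solution , coprime
  where
  p>0 : 0 < p
  p>0 = prime>0 pp

  solution⇒modulus : (∃ λ u → ∃ λ v → 0 < u × 0 < v × Solution p (d * u) (d * v) (d * u * v)) →
    ∃ λ n → 0 < n × (4 * d * n ∸ 1) ∣ (p + 4 * d)
  solution⇒modulus (u , v , u>0 , v>0 , sol) =
    reducedEquation⇒modulus pp d>0 u>0 v>0 (solution⇒reducedEquation d>0 u>0 v>0 sol)

  modulus⇒solution : (∃ λ n → 0 < n × (4 * d * n ∸ 1) ∣ (p + 4 * d)) →
    ∃ λ u → ∃ λ v → 0 < u × 0 < v × Solution p (d * u) (d * v) (d * u * v)
  modulus⇒solution (n , n>0 , e∣p+4d) with modulus⇒reducedEquation p>0 d>0 n>0 e∣p+4d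
  ... | c , c>0 , eq = reducedEquation⇒orderedSolution p>0 d>0 (*-pos p>0 n>0) c>0 eq

  coprime : (u v : ℕ) → 0 < u → 0 < v → Solution p (d * u) (d * v) (d * u * v) → gcd u v ≡ 1
  coprime u v u>0 v>0 sol = reducedEquation⇒coprime {d = d} pp (solution⇒reducedEquation d>0 u>0 v>0 sol)
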